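{- Let $G=(V,E)$ be a finite graph, $u\in V$ and $\pi$ a profile on $G$. If the polytope $\mathrm{dM}(\pi,u)$ is non-empty, then $\pi^2$ admits a perfect pairing. Consequently, if $\pi^{2k}$ admits a perfect pairing for some integer $k\ge 1$, then $\pi^2$ admits a perfect pairing.
   Context: $G$ is finite, connected and simple with distance $d$ and intervals $I(a,b)=\{w:d(a,w)+d(w,b)=d(a,b)\}$. A profile is a finite sequence of vertices (repetitions allowed); $\pi(v)$ is the multiplicity of $v$; $\pi^k$ is the $k$-fold concatenation of $\pi$; $F_\pi(v)=\sum_x\pi(x)d(v,x)$. For a profile of even length $2n$, a pairing $P$ is a partition of $\pi$ into $n$ pairs, $D_\pi(P)=\sum_{\{a,b\}\in P}d(a,b)$, and $P$ is perfect if $D_\pi(P)=F_\pi(v)$ for some vertex $v$. The auxiliary graph $A_u=(V,E_u)$ has an edge $\{v,w\}$ whenever $u\in I(v,w)$ (this includes a loop at $u$ and no other loops). $\mathrm{dM}(\pi,u)$ is the set of $x:E_u\to\mathbb{R}_{\ge 0}$ such that for every $v\in V$, $\sum_{e\ni v}x(e)=\pi(v)$, where a loop at $v$ is counted twice in this sum (i.e., the fractional perfect $\pi$-matchings of $A_u$).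
   Formalization: The points $x$ of the polytope $\mathrm{dM}(\pi,u)$ take only rational values instead of real ones. -}

module Defs where

open import Data.Nat using (ℕ; zero; suc; _+_; _≤_)
open import Data.Fin using (Fin; _≟_)
open import Data.List using (List; []; _∷_; _++_; map; foldr; allFin)
import Data.List as L
open import Data.Product using (Σ; ∃; _×_; _,_)
open import Data.Empty using (⊥)
open import Relation.Nullary using (¬_; yes; no)
open import Relation.Binary.PropositionalEquality using (_≡_)
open import Data.List.Relation.Binary.Permutation.Propositional using (_↭_)
open import Data.Integer using (+_)
open import Data.Rational using (ℚ; 0ℚ; _/_) renaming (_+_ to _+ℚ_; _≤_ to _≤ℚ_)

record SimpleGraph (n : ℕ) : Set₁ where
  field
    Adj     : Fin n → Fin n → Set
    sym     : ∀ {v w} → Adj v w → Adj w v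
    irrefl  : ∀ {v} → ¬ Adj v v

module _ {n : ℕ} (G : SimpleGraph n) where
  open SimpleGraph G

  data Walk : Fin n → Fin n → ℕ → Set where
    here : ∀ {a} → Walk a a zero
    step : ∀ {a b c k} → Adj a b → Walk b c k → Walk a c (suc k)

  record IsDistance (d : Fin n → Fin n → ℕ) : Set where
    field
      realised : ∀ a b → Walk a b (d a b)
      minimal  : ∀ a b k → Walk a b k → d a b ≤ k

  Connected : Set
  Connected = ∀ a b → ∃ λ k → Walk a b k

Profile : ℕ → Set
Profile n = List (Fin n)

mult : ∀ {n} → Profile n → Fin n → ℕ
mult []       v = zero
mult (x ∷ π) v with x ≟ v
... | yes _ = suc (mult π v)
... | no  _ = mult π v

_^ᵖ_ : ∀ {n} → Profile n → ℕ → Profile n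
π ^ᵖ zero  = []
π ^ᵖ suc k = π ++ (π ^ᵖ k)

sumℕ : List ℕ → ℕ
sumℕ = foldr _+_ zero

module Dist {n : ℕ} (d : Fin n → Fin n → ℕ) where

  F : Profile n → Fin n → ℕ
  F π v = sumℕ (map (d v) π)

  -- a pairing of π: a list of pairs whose entries, taken together, are π
  -- up to reordering (i.e. a partition of the multiset π into pairs)
  flatten : List (Fin n × Fin n) → Profile n
  flatten []             = []
  flatten ((a , b) ∷ P)  = a ∷ b ∷ flatten P

  IsPairing : Profile n → List (Fin n × Fin n) → Set
  IsPairing π P = flatten P ↭ π

  D : List (Fin n × Fin n) → ℕ
  D P = sumℕ (map (λ { (a , b) → d a b }) P)

  IsPerfect : Profile n → List (Fin n × Fin n) → Set
  IsPerfect π P = ∃ λ v → D P ≡ F π v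

  AdmitsPerfectPairing : Profile n → Set
  AdmitsPerfectPairing π = ∃ λ P → IsPairing π P × IsPerfect π P

  InInterval : Fin n → Fin n → Fin n → Set
  InInterval u v w = d v u + d u w ≡ d v w

  sumℚ : List ℚ → ℚ
  sumℚ = foldr _+ℚ_ 0ℚ

  ℕ→ℚ : ℕ → ℚ
  ℕ→ℚ m = (+ m) / 1

  -- x ∈ dM(π,u): a nonnegative weighting of the edges of A_u
  -- (an edge {v,w} is represented by the symmetric value x v w = x w v),
  -- vanishing off E_u, such that for each v the sum over edges at v,
  -- with the loop {v,v} counted twice, equals π(v).
  record InDM (π : Profile n) (u : Fin n) (x : Fin n → Fin n → ℚ) : Set where
    field
      symmetric : ∀ v w → x v w ≡ x w v
      nonneg    : ∀ v w → 0ℚ ≤ℚ x v w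
      support   : ∀ v w → ¬ InInterval u v w → x v w ≡ 0ℚ
      degree    : ∀ v → sumℚ (map (x v) (allFin n)) +ℚ x v v ≡ ℕ→ℚ (mult π v)

  DMNonEmpty : Profile n → Fin n → Set
  DMNonEmpty π u = ∃ λ x → InDM π u x

-- Both parts go through an integral version of dM(π,u): a symmetric ℕ-matrix Y whose rows sum
-- to N·π for some N > 0 and which is supported on pairs (v,w) with u ∈ I(v,w). A point of
-- dM(π,u) gives one after clearing denominators. A perfect pairing P of π^j gives one with N = j:
-- by the triangle inequality D(P) ≤ F(v) for every v, with equality only if v lies in the interval
-- of every pair of P, so counting the pairs of P in both orientations yields Y for that v.
-- Conversely, Y/N is a fractional transport plan from π to π along such pairs, and Hall's theorem
-- for supplies and demands (by induction on the total supply, either splitting at a tight set or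
-- routing one unit along an edge) provides an integral plan Z. Repeating each pair (v,w) Z(v,w)
-- times pairs off π² so that u lies in every interval, which makes the pairing perfect at u.

module Submission where

open import Defs

open import Data.Bool using (Bool; true; false; T; not; _∧_; _∨_)
open import Data.Bool.Properties using (T-∧; T-∨)
open import Data.Empty using (⊥-elim)
open import Data.Fin using (Fin; zero; suc; _≟_)
open import Data.Fin.Properties using (any?)
open import Data.Fin.Subset.Properties using (anySubset?)
import Data.Integer as ℤ
import Data.Integer.Properties as ℤ
import Data.List as List
open import Data.List using (List; []; _∷_; _++_; [_])
open import Data.List.Membership.Propositional using (_∈_)
open import Data.List.Membership.Propositional.Properties using (∈-∃++)
open import Data.List.Properties using (map-++; map-tabulate)
open import Data.List.Relation.Binary.Permutation.Propositional using (_↭_; ↭-refl; ↭-sym; ↭-trans; prep)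
open import Data.List.Relation.Binary.Permutation.Propositional.Properties using (map⁺; shift)
open import Data.List.Relation.Unary.All as All using (All; []; _∷_)
open import Data.List.Relation.Unary.All.Properties using (concat⁺; tabulate⁺; replicate⁺)
open import Data.List.Relation.Unary.Any using (here; there)
open import Data.Nat using (ℕ; zero; suc; _+_; _*_; _∸_; _≤_; _<_; z≤n; z<s; NonZero) renaming (_≟_ to _≟ℕ_)
open import Data.Nat.Divisibility using (_∣_; divides; ∣-trans; m∣m*n; ∣n⇒∣m*n)
open import Data.Nat.ListAction.Properties using (sum-++; sum-↭)
open import Data.Nat.Properties hiding (_≟_)
open import Data.Product using (Σ; ∃; _×_; _,_; proj₁; proj₂)
open import Data.Rational using (ℚ; mkℚ; 0ℚ; ↧ₙ_; toℚᵘ; *≤*) renaming (_+_ to _+ℚ_; _≤_ to _≤ℚ_)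
open import Data.Rational.Properties using (toℚᵘ-homo-+; toℚᵘ-fromℚᵘ; toℚᵘ-cong)
open import Data.Rational.Unnormalised using (ℚᵘ; mkℚᵘ; _≃_; *≡*) renaming (_+_ to _+ᵘ_; _*_ to _*ᵘ_)
import Data.Rational.Unnormalised.Properties as ℚᵘ
open import Data.Sum using (_⊎_; inj₁; inj₂)
open import Data.Unit using (tt)
open import Data.Vec using (lookup; tabulate)
open import Data.Vec.Properties using (lookup∘tabulate)
open import Function using (_∘_)
open import Function.Bundles using (Equivalence; mk⇔)
open import Relation.Binary.PropositionalEquality
  using (_≡_; refl; sym; trans; cong; cong₂; subst; subst₂; module ≡-Reasoning)
open import Relation.Nullary using (Dec; does; yes; no; ¬_; _×-dec_)
open import Relation.Nullary.Decidable using (⌊_⌋; T?; toWitness; fromWitness; does-⇔)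

open import Algebra.Properties.CommutativeSemigroup +-commutativeSemigroup using (interchange)
open import Algebra.Properties.Semiring.Sum +-*-semiring
  using (sum; ∑-comm; ∑-distrib-+; sum-cong-≗; *-distribˡ-sum; sum-replicate-zero)

infix 8 [_]·_

[_]·_ : Bool → ℕ → ℕ
[ true  ]· m = m
[ false ]· m = 0

[]·-≤ : ∀ b m → [ b ]· m ≤ m
[]·-≤ true  m = ≤-refl
[]·-≤ false m = z≤n

[]·-mono : ∀ {a b} m → (T a → T b) → [ a ]· m ≤ [ b ]· m
[]·-mono {false}         m _   = z≤n
[]·-mono {true}  {true}  m _   = ≤-refl
[]·-mono {true}  {false} m a⇒b = ⊥-elim (a⇒b tt)

[]·-positive : ∀ b m → 0 < [ b ]· m → T b × 0 < m
[]·-positive true m 0<m = tt , 0<m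

[]·-zero : ∀ b → [ b ]· 0 ≡ 0
[]·-zero true  = refl
[]·-zero false = refl

[]·-∧ : ∀ a b m → [ a ∧ b ]· m ≡ [ a ]· [ b ]· m
[]·-∧ true  b m = refl
[]·-∧ false b m = refl

[]·-comm : ∀ a b m → [ a ]· [ b ]· m ≡ [ b ]· [ a ]· m
[]·-comm true  b m = refl
[]·-comm false b m = sym ([]·-zero b)

[]·-distrib-+ : ∀ b m k → [ b ]· (m + k) ≡ [ b ]· m + [ b ]· k
[]·-distrib-+ true  m k = refl
[]·-distrib-+ false m k = refl

*-[]· : ∀ b k m → k * [ b ]· m ≡ [ b ]· (k * m)
*-[]· true  k m = refl
*-[]· false k m = *-zeroʳ k

[]·-split : ∀ b m → m ≡ [ b ]· m + [ not b ]· m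
[]·-split true  m = sym (+-identityʳ m)
[]·-split false m = refl

[]·-∨ : ∀ a b m → [ a ]· m + [ b ]· [ not a ]· m ≡ [ a ∨ b ]· m
[]·-∨ true  b m = trans (cong (m +_) ([]·-zero b)) (+-identityʳ m)
[]·-∨ false b m = refl

δ : ∀ {n} → Fin n → Fin n → ℕ
δ a i = [ does (a ≟ i) ]· 1

+-≤-≡⇒≡ : ∀ {a b c d} → a ≤ b → c ≤ d → a + c ≡ b + d → a ≡ b × c ≡ d
+-≤-≡⇒≡ {a} {b} {c} {d} a≤b c≤d a+c≡b+d =
  ≤-antisym a≤b (+-cancelʳ-≤ d b a (subst (_≤ a + d) a+c≡b+d (+-monoʳ-≤ a c≤d))) ,
  ≤-antisym c≤d (+-cancelˡ-≤ b d c (subst (_≤ b + c) a+c≡b+d (+-monoˡ-≤ c a≤b)))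

+-positive : ∀ a {b} → 0 < a + b → 0 < a ⊎ 0 < b
+-positive zero    0<b = inj₂ 0<b
+-positive (suc a) _   = inj₁ z<s

≤-without-units : ∀ a b {x y} → [ a ]· 1 + x ≤ [ b ]· 1 + y →
  (a ≡ false → 0 < x → x < [ b ]· 1 + y) → x ≤ y
≤-without-units true  b                 x≤y _      = ≤-pred (≤-trans x≤y (+-monoˡ-≤ _ ([]·-≤ b 1)))
≤-without-units false false           x≤y _      = x≤y
≤-without-units false true  {zero}    _   _      = z≤n
≤-without-units false true  {suc x}   _   strict = ≤-pred (strict refl z<s)

sum-[]· : ∀ {n} b (f : Fin n → ℕ) → sum (λ i → [ b ]· f i) ≡ [ b ]· sum f
sum-[]· true  f = refl
sum-[]· {n} false f = sum-replicate-zero n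

sum-mono-≤ : ∀ {n} {f g : Fin n → ℕ} → (∀ i → f i ≤ g i) → sum f ≤ sum g
sum-mono-≤ {zero}  f≤g = z≤n
sum-mono-≤ {suc n} f≤g = +-mono-≤ (f≤g zero) (sum-mono-≤ (f≤g ∘ suc))

≤-sum : ∀ {n} (f : Fin n → ℕ) i → f i ≤ sum f
≤-sum f zero    = m≤m+n _ _
≤-sum f (suc i) = ≤-trans (≤-sum (f ∘ suc) i) (m≤n+m _ _)

sum≡0⇒≡0 : ∀ {n} (f : Fin n → ℕ) → sum f ≡ 0 → ∀ i → f i ≡ 0
sum≡0⇒≡0 f Σf≡0 i = n≤0⇒n≡0 (subst (f i ≤_) Σf≡0 (≤-sum f i))

sum-positive : ∀ {n} (f : Fin n → ℕ) → 0 < sum f → ∃ λ i → 0 < f i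
sum-positive {suc n} f 0<Σf with f zero in eq
... | suc _ = zero , subst (0 <_) (sym eq) z<s
... | zero  with sum-positive (f ∘ suc) 0<Σf
...   | i , 0<fi = suc i , 0<fi

sum-≡⇒≗ : ∀ {n} {f g : Fin n → ℕ} → (∀ i → f i ≤ g i) → sum f ≡ sum g → ∀ i → f i ≡ g i
sum-≡⇒≗ {suc n} f≤g Σf≡Σg with +-≤-≡⇒≡ (f≤g zero) (sum-mono-≤ (f≤g ∘ suc)) Σf≡Σg
... | head≡ , tail≡ = λ { zero → head≡ ; (suc i) → sum-≡⇒≗ (f≤g ∘ suc) tail≡ i }

sum-δ : ∀ {n} (f : Fin n → ℕ) a → sum (λ i → [ does (a ≟ i) ]· f i) ≡ f a
sum-δ {suc n} f zero    = trans (cong (f zero +_) (sum-replicate-zero n)) (+-identityʳ _)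
sum-δ {suc n} f (suc a) = sum-δ {n} (f ∘ suc) a

≟-sound : ∀ {n} {a b : Fin n} → T (does (a ≟ b)) → a ≡ b
≟-sound {a = a} {b} p with a ≟ b
... | yes a≡b = a≡b

≟-sym : ∀ {n} (a b : Fin n) → does (a ≟ b) ≡ does (b ≟ a)
≟-sym a b = does-⇔ (mk⇔ sym sym) (a ≟ b) (b ≟ a)

sum-δ′ : ∀ {n} (f : Fin n → ℕ) a → sum (λ i → [ does (i ≟ a) ]· f i) ≡ f a
sum-δ′ {suc n} f zero    = trans (cong (f zero +_) (sum-replicate-zero n)) (+-identityʳ _)
sum-δ′ {suc n} f (suc a) = sum-δ′ {n} (f ∘ suc) a

sum-δ-1 : ∀ {n} (a : Fin n) → sum (δ a) ≡ 1
sum-δ-1 = sum-δ (λ _ → 1)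

infixl 9 _↾_

_↾_ : ∀ {k} → (Fin k → ℕ) → (Fin k → Bool) → Fin k → ℕ
(f ↾ A) i = [ A i ]· f i

weight : ∀ {k} → (Fin k → ℕ) → (Fin k → Bool) → ℕ
weight f A = sum (f ↾ A)

module _ {k : ℕ} where

  weight-cong : ∀ f {A B : Fin k → Bool} → (∀ i → A i ≡ B i) → weight f A ≡ weight f B
  weight-cong f A≗B = sum-cong-≗ (λ i → cong ([_]· f i) (A≗B i))

  weight-↾ : ∀ (f : Fin k → ℕ) A B → weight (f ↾ A) B ≡ weight f (λ i → B i ∧ A i)
  weight-↾ f A B = sum-cong-≗ (λ i → sym ([]·-∧ (B i) (A i) (f i)))

  weight-+ : ∀ (f g : Fin k → ℕ) A → weight (λ i → f i + g i) A ≡ weight f A + weight g A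
  weight-+ f g A = trans (sum-cong-≗ (λ i → []·-distrib-+ (A i) (f i) (g i))) (∑-distrib-+ (f ↾ A) (g ↾ A))

  weight-δ : ∀ (a : Fin k) A → weight (δ a) A ≡ [ A a ]· 1
  weight-δ a A = trans (sum-cong-≗ (λ i → []·-comm (A i) (does (a ≟ i)) 1)) (sum-δ (λ i → [ A i ]· 1) a)

  weight-mono : ∀ f {A B : Fin k → Bool} → (∀ i → T (A i) → T (B i)) → weight f A ≤ weight f B
  weight-mono f A⊆B = sum-mono-≤ (λ i → []·-mono (f i) (A⊆B i))

  sum≡weight+weight : ∀ (f : Fin k → ℕ) A → sum f ≡ weight f A + weight f (not ∘ A)
  sum≡weight+weight f A = trans (sum-cong-≗ (λ i → []·-split (A i) (f i))) (∑-distrib-+ (f ↾ A) (f ↾ (not ∘ A)))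

  weight+weight≡weight-∨ : ∀ (f : Fin k → ℕ) A B →
    weight f A + weight (f ↾ (not ∘ A)) B ≡ weight f (λ i → A i ∨ B i)
  weight+weight≡weight-∨ f A B =
    trans (sym (∑-distrib-+ (f ↾ A) _)) (sum-cong-≗ (λ i → []·-∨ (A i) (B i) (f i)))

  weight<sum : ∀ (f : Fin k → ℕ) A {a} → 0 < f a → A a ≡ false → weight f A < sum f
  weight<sum f A {a} 0<fa Aa≡false = begin-strict
    weight f A                          <⟨ m<m+n _ (<-≤-trans 0<fa fa≤) ⟩
    weight f A + weight f (not ∘ A)     ≡⟨ sum≡weight+weight f A ⟨
    sum f                               ∎
    where
    open ≤-Reasoning
    fa≤ : f a ≤ weight f (not ∘ A)
    fa≤ = subst (λ b → [ not b ]· f a ≤ weight f (not ∘ A)) Aa≡false (≤-sum (f ↾ (not ∘ A)) a)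

  decrement : (Fin k → ℕ) → Fin k → Fin k → ℕ
  decrement f a i = f i ∸ δ a i

  δ+decrement : ∀ f a → 0 < f a → ∀ i → δ a i + decrement f a i ≡ f i
  δ+decrement f a 0<fa i with a ≟ i
  ... | yes refl = m+[n∸m]≡n 0<fa
  ... | no  _    = refl

  weight-decrement : ∀ f a → 0 < f a → ∀ A → weight f A ≡ [ A a ]· 1 + weight (decrement f a) A
  weight-decrement f a 0<fa A = begin
    weight f A                                ≡⟨ sum-cong-≗ (λ i → cong ([ A i ]·_) (δ+decrement f a 0<fa i)) ⟨
    weight (λ i → δ a i + decrement f a i) A  ≡⟨ weight-+ (δ a) (decrement f a) A ⟩
    weight (δ a) A + weight (decrement f a) A ≡⟨ cong (_+ weight (decrement f a) A) (weight-δ a A) ⟩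
    [ A a ]· 1 + weight (decrement f a) A     ∎
    where open ≡-Reasoning

-- Hall's theorem for supply and demand

module Hall {m n : ℕ} {S : Fin m → Fin n → Set} (S? : ∀ v w → Dec (S v w)) where

  neighbours : (Fin m → Bool) → Fin n → Bool
  neighbours A w = ⌊ any? (λ v → T? (A v) ×-dec S? v w) ⌋

  neighbour : ∀ {A v w} → T (A v) → S v w → T (neighbours A w)
  neighbour Av Svw = fromWitness (_ , Av , Svw)

  neighbours-mono : ∀ {A B} → (∀ v → T (A v) → T (B v)) → ∀ w → T (neighbours A w) → T (neighbours B w)
  neighbours-mono A⊆B w NAw with toWitness NAw
  ... | v , Av , Svw = neighbour (A⊆B v Av) Svw

  neighbours-cong : ∀ {A B} → (∀ v → A v ≡ B v) → ∀ w → neighbours A w ≡ neighbours B w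
  neighbours-cong A≗B w = T-injective
    (neighbours-mono (λ v → subst T (A≗B v)) w) (neighbours-mono (λ v → subst T (sym (A≗B v))) w)
    where
    T-injective : ∀ {a b} → (T a → T b) → (T b → T a) → a ≡ b
    T-injective {false} {false} _ _ = refl
    T-injective {false} {true}  _ b⇒a = ⊥-elim (b⇒a tt)
    T-injective {true}  {false} a⇒b _ = ⊥-elim (a⇒b tt)
    T-injective {true}  {true}  _ _ = refl

  HallCondition : (Fin m → ℕ) → (Fin n → ℕ) → Set
  HallCondition r c = ∀ A → weight r A ≤ weight c (neighbours A)

  record Transport (r : Fin m → ℕ) (c : Fin n → ℕ) : Set where
    field
      plan    : Fin m → Fin n → ℕ
      support : ∀ v w → 0 < plan v w → S v w
      rowSum  : ∀ v → sum (plan v) ≡ r v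
      colSum≤ : ∀ w → sum (λ v → plan v w) ≤ c w

    colSum : sum r ≡ sum c → ∀ w → sum (λ v → plan v w) ≡ c w
    colSum Σr≡Σc = sum-≡⇒≗ colSum≤ (begin
      sum (λ w → sum (λ v → plan v w)) ≡⟨ ∑-comm plan ⟨
      sum (λ v → sum (plan v))         ≡⟨ sum-cong-≗ rowSum ⟩
      sum r                            ≡⟨ Σr≡Σc ⟩
      sum c                            ∎)
      where open ≡-Reasoning

  open Transport

  empty-transport : ∀ {r c} → (∀ v → r v ≡ 0) → Transport r c
  empty-transport {c = c} r≗0 = record
    { plan    = λ _ _ → 0
    ; support = λ _ _ ()
    ; rowSum  = λ v → trans (sum-replicate-zero n) (sym (r≗0 v))
    ; colSum≤ = λ w → subst (_≤ c w) (sym (sum-replicate-zero m)) z≤n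
    }

  unit-transport : ∀ {v w} → S v w → Transport (δ v) (δ w)
  unit-transport {v} {w} Svw = record
    { plan    = λ x y → [ does (v ≟ x) ]· δ w y
    ; support = unit-support
    ; rowSum  = λ x → trans (sum-[]· (does (v ≟ x)) (δ w)) (cong ([ does (v ≟ x) ]·_) (sum-δ-1 w))
    ; colSum≤ = λ y → ≤-reflexive (sum-δ (λ _ → δ w y) v)
    }
    where
    unit-support : ∀ x y → 0 < [ does (v ≟ x) ]· δ w y → S x y
    unit-support x y p with v ≟ x | w ≟ y
    ... | yes refl | yes refl = Svw
    ... | no _     | _        = ⊥-elim (<-irrefl refl p)
    ... | yes refl | no _     = ⊥-elim (<-irrefl refl p)

  combine-transports : ∀ {r₁ r₂ r c₁ c₂ c} → Transport r₁ c₁ → Transport r₂ c₂ →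
    (∀ v → r₁ v + r₂ v ≡ r v) → (∀ w → c₁ w + c₂ w ≤ c w) → Transport r c
  combine-transports {r₁} {r₂} {r} {c₁} {c₂} {c} t₁ t₂ r₁+r₂≡r c₁+c₂≤c = record
    { plan    = plan′
    ; support = support′
    ; rowSum  = λ v → begin-equality
        sum (plan′ v)                    ≡⟨ ∑-distrib-+ (plan t₁ v) (plan t₂ v) ⟩
        sum (plan t₁ v) + sum (plan t₂ v) ≡⟨ cong₂ _+_ (rowSum t₁ v) (rowSum t₂ v) ⟩
        r₁ v + r₂ v                      ≡⟨ r₁+r₂≡r v ⟩
        r v                              ∎
    ; colSum≤ = λ w → begin
        sum (λ v → plan′ v w)                             ≡⟨ ∑-distrib-+ (λ v → plan t₁ v w) _ ⟩
        sum (λ v → plan t₁ v w) + sum (λ v → plan t₂ v w) ≤⟨ +-mono-≤ (colSum≤ t₁ w) (colSum≤ t₂ w) ⟩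
        c₁ w + c₂ w                                       ≤⟨ c₁+c₂≤c w ⟩
        c w                                               ∎
    }
    where
    open ≤-Reasoning
    plan′ : Fin m → Fin n → ℕ
    plan′ v w = plan t₁ v w + plan t₂ v w
    support′ : ∀ v w → 0 < plan′ v w → S v w
    support′ v w p with +-positive (plan t₁ v w) p
    ... | inj₁ 0<plan₁ = support t₁ v w 0<plan₁
    ... | inj₂ 0<plan₂ = support t₂ v w 0<plan₂

  hall-inside : ∀ {r c} A → HallCondition r c → HallCondition (r ↾ A) (c ↾ neighbours A)
  hall-inside {r} {c} A H B = begin
    weight (r ↾ A) B                                 ≡⟨ weight-↾ r A B ⟩
    weight r (λ v → B v ∧ A v)                       ≤⟨ H _ ⟩
    weight c (neighbours (λ v → B v ∧ A v))          ≤⟨ weight-mono c N[B∧A]⊆NB∧NA ⟩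
    weight c (λ w → neighbours B w ∧ neighbours A w) ≡⟨ weight-↾ c (neighbours A) (neighbours B) ⟨
    weight (c ↾ neighbours A) (neighbours B)         ∎
    where
    open ≤-Reasoning
    N[B∧A]⊆NB∧NA : ∀ w → T (neighbours (λ v → B v ∧ A v) w) → T (neighbours B w ∧ neighbours A w)
    N[B∧A]⊆NB∧NA w p = Equivalence.from T-∧
      ( neighbours-mono (λ v → proj₁ ∘ Equivalence.to (T-∧ {B v})) w p
      , neighbours-mono (λ v → proj₂ ∘ Equivalence.to (T-∧ {B v})) w p )

  hall-outside : ∀ {r c} A → HallCondition r c → weight c (neighbours A) ≤ weight r A →
    HallCondition (r ↾ (not ∘ A)) (c ↾ (not ∘ neighbours A))
  hall-outside {r} {c} A H cNA≤rA B = +-cancelˡ-≤ (weight r A) _ _ (begin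
    weight r A + weight (r ↾ (not ∘ A)) B              ≡⟨ weight+weight≡weight-∨ r A B ⟩
    weight r (λ v → A v ∨ B v)                         ≤⟨ H _ ⟩
    weight c (neighbours (λ v → A v ∨ B v))            ≤⟨ weight-mono c N[A∨B]⊆NA∨NB ⟩
    weight c (λ w → neighbours A w ∨ neighbours B w)   ≡⟨ weight+weight≡weight-∨ c (neighbours A) _ ⟨
    weight c (neighbours A) + weight c′ (neighbours B) ≤⟨ +-monoˡ-≤ _ cNA≤rA ⟩
    weight r A + weight c′ (neighbours B)              ∎)
    where
    open ≤-Reasoning
    c′ : Fin n → ℕ
    c′ = c ↾ (not ∘ neighbours A)
    N[A∨B]⊆NA∨NB : ∀ w → T (neighbours (λ v → A v ∨ B v) w) → T (neighbours A w ∨ neighbours B w)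
    N[A∨B]⊆NA∨NB w p with toWitness p
    ... | v , A∨Bv , Svw with Equivalence.to (T-∨ {A v}) A∨Bv
    ...   | inj₁ Av = Equivalence.from T-∨ (inj₁ (neighbour Av Svw))
    ...   | inj₂ Bv = Equivalence.from T-∨ (inj₂ (neighbour Bv Svw))

  Tight : (Fin m → ℕ) → (Fin n → ℕ) → (Fin m → Bool) → Set
  Tight r c A = 0 < weight r A × weight r A < sum r × weight c (neighbours A) ≤ weight r A

  tight? : ∀ r c A → Dec (Tight r c A)
  tight? r c A = (0 <? weight r A) ×-dec (weight r A <? sum r) ×-dec (weight c (neighbours A) ≤? weight r A)

  Tight-cong : ∀ {r c A B} → (∀ v → A v ≡ B v) → Tight r c A → Tight r c B
  Tight-cong {r} {c} A≗B rewrite weight-cong r A≗B | weight-cong c (neighbours-cong A≗B) = λ tight → tight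

  tight-or-none : ∀ r c → (∃ λ A → Tight r c A) ⊎ (∀ A → ¬ Tight r c A)
  tight-or-none r c with anySubset? (tight? r c ∘ lookup)
  ... | yes (A , tight) = inj₁ (lookup A , tight)
  ... | no  ∄tight      = inj₂ λ A tight → ∄tight (tabulate A , Tight-cong (λ v → sym (lookup∘tabulate A v)) tight)

  hall-decrement : ∀ {r c v w} → HallCondition r c → (∀ A → ¬ Tight r c A) → 0 < r v → 0 < c w →
    HallCondition (decrement r v) (decrement c w)
  hall-decrement {r} {c} {v} {w} H noTight 0<rv 0<cw B =
    ≤-without-units (B v) (neighbours B w) (subst₂ _≤_ rB≡ cNB≡ (H B)) strict
    where
    rB≡ : weight r B ≡ [ B v ]· 1 + weight (decrement r v) B
    rB≡ = weight-decrement r v 0<rv B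
    cNB≡ : weight c (neighbours B) ≡ [ neighbours B w ]· 1 + weight (decrement c w) (neighbours B)
    cNB≡ = weight-decrement c w 0<cw (neighbours B)
    strict : B v ≡ false → 0 < weight (decrement r v) B →
      weight (decrement r v) B < [ neighbours B w ]· 1 + weight (decrement c w) (neighbours B)
    strict Bv≡false 0<r′B = subst₂ _<_ rB≡r′B cNB≡
      (≰⇒> λ cNB≤rB → noTight B (subst (0 <_) (sym rB≡r′B) 0<r′B , weight<sum r B 0<rv Bv≡false , cNB≤rB))
      where
      rB≡r′B : weight r B ≡ weight (decrement r v) B
      rB≡r′B = trans rB≡ (cong (λ b → [ b ]· 1 + weight (decrement r v) B) Bv≡false)

  Solvable : ℕ → Set
  Solvable k = ∀ {r c} → sum r ≤ k → HallCondition r c → Transport r c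

  split-at-tight : ∀ {k r c} A → Solvable k → sum r ≤ suc k → HallCondition r c → Tight r c A →
    Transport r c
  split-at-tight {k} {r} {c} A solve Σr≤1+k H (0<rA , rA<Σr , cNA≤rA) =
    combine-transports (solve Σr↾A≤k (hall-inside A H)) (solve Σr↾Aᶜ≤k (hall-outside A H cNA≤rA))
      (λ v → sym ([]·-split (A v) (r v))) (λ w → ≤-reflexive (sym ([]·-split (neighbours A w) (c w))))
    where
    Σr↾A≤k : weight r A ≤ k
    Σr↾A≤k = ≤-pred (≤-trans rA<Σr Σr≤1+k)
    Σr↾Aᶜ≤k : weight r (not ∘ A) ≤ k
    Σr↾Aᶜ≤k = ≤-pred (≤-trans (+-monoˡ-≤ _ 0<rA) (subst (_≤ suc k) (sum≡weight+weight r A) Σr≤1+k))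

  remove-unit : ∀ {k r c} → Solvable k → sum r ≤ suc k → HallCondition r c → 0 < sum r →
    (∀ A → ¬ Tight r c A) → Transport r c
  remove-unit {k} {r} {c} solve Σr≤1+k H 0<Σr noTight =
    combine-transports (unit-transport Svw) (solve Σr′≤k (hall-decrement H noTight 0<rv 0<cw))
      (δ+decrement r v 0<rv) (λ y → ≤-reflexive (δ+decrement c w 0<cw y))
    where
    v : Fin m
    v = proj₁ (sum-positive r 0<Σr)
    0<rv : 0 < r v
    0<rv = proj₂ (sum-positive r 0<Σr)
    ⁅v⁆ : Fin m → Bool
    ⁅v⁆ x = does (v ≟ x)
    -- Hall's condition for ⁅v⁆ yields a neighbour w of v with positive capacity.
    0<cN⁅v⁆ : 0 < weight c (neighbours ⁅v⁆)
    0<cN⁅v⁆ = <-≤-trans 0<rv (subst (_≤ weight c (neighbours ⁅v⁆)) (sum-δ r v) (H ⁅v⁆))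
    w : Fin n
    w = proj₁ (sum-positive (c ↾ neighbours ⁅v⁆) 0<cN⁅v⁆)
    N⁅v⁆w×0<cw : T (neighbours ⁅v⁆ w) × 0 < c w
    N⁅v⁆w×0<cw = []·-positive _ _ (proj₂ (sum-positive (c ↾ neighbours ⁅v⁆) 0<cN⁅v⁆))
    0<cw : 0 < c w
    0<cw = proj₂ N⁅v⁆w×0<cw
    Svw : S v w
    Svw with toWitness (proj₁ N⁅v⁆w×0<cw)
    ... | x , v≡x , Sxw = subst (λ y → S y w) (sym (≟-sound v≡x)) Sxw
    Σr′≤k : sum (decrement r v) ≤ k
    Σr′≤k = ≤-pred (subst (_≤ suc k) (weight-decrement r v 0<rv (λ _ → true)) Σr≤1+k)

  hall : ∀ k → Solvable k
  hall zero    {r} Σr≤0 H = empty-transport (sum≡0⇒≡0 r (n≤0⇒n≡0 Σr≤0))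
  hall (suc k) {r} {c} Σr≤1+k H with sum r ≟ℕ 0 | tight-or-none r c
  ... | yes Σr≡0 | _                = empty-transport (sum≡0⇒≡0 r Σr≡0)
  ... | no  Σr≢0 | inj₁ (A , tight) = split-at-tight A (hall k) Σr≤1+k H tight
  ... | no  Σr≢0 | inj₂ noTight     = remove-unit (hall k) Σr≤1+k H (n≢0⇒n>0 Σr≢0) noTight

module _ {m n : ℕ} (Y : Fin m → Fin n → ℕ) (N : ℕ) .{{_ : NonZero N}} {r : Fin m → ℕ} {c : Fin n → ℕ}
  (rowSum : ∀ v → sum (Y v) ≡ N * r v) (colSum : ∀ w → sum (λ v → Y v w) ≡ N * c w) where

  open Hall (λ v w → 0 <? Y v w)

  private
    *-weight : ∀ {k} (f : Fin k → ℕ) A → N * weight f A ≡ weight (λ i → N * f i) A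
    *-weight f A = trans (*-distribˡ-sum N (f ↾ A)) (sum-cong-≗ (λ i → *-[]· (A i) N (f i)))

  scaled-hall-condition : HallCondition r c
  scaled-hall-condition A = *-cancelˡ-≤ N (begin
    N * weight r A                                ≡⟨ *-weight r A ⟩
    weight (λ v → N * r v) A                      ≡⟨ rows ⟨
    sum (λ v → [ A v ]· sum (Y v))                ≡⟨ sum-cong-≗ (λ v → sum-[]· (A v) (Y v)) ⟨
    sum (λ v → sum (λ w → [ A v ]· Y v w))        ≤⟨ sum-mono-≤ (λ v → sum-mono-≤ (A⇒NA v)) ⟩
    sum (λ v → sum (λ w → [ NA w ]· Y v w))       ≡⟨ ∑-comm (λ v w → [ NA w ]· Y v w) ⟩
    sum (λ w → sum (λ v → [ NA w ]· Y v w))       ≡⟨ sum-cong-≗ (λ w → sum-[]· (NA w) (λ v → Y v w)) ⟩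
    sum (λ w → [ NA w ]· sum (λ v → Y v w))       ≡⟨ sum-cong-≗ (λ w → cong ([ NA w ]·_) (colSum w)) ⟩
    weight (λ w → N * c w) NA                     ≡⟨ *-weight c NA ⟨
    N * weight c NA                               ∎)
    where
    open ≤-Reasoning
    NA : Fin n → Bool
    NA = neighbours A
    rows : sum (λ v → [ A v ]· sum (Y v)) ≡ weight (λ v → N * r v) A
    rows = sum-cong-≗ (λ v → cong ([ A v ]·_) (rowSum v))
    A⇒NA : ∀ v w → [ A v ]· Y v w ≤ [ NA w ]· Y v w
    A⇒NA v w with Y v w in eq
    ... | zero  = ≤-reflexive (trans ([]·-zero (A v)) (sym ([]·-zero (NA w))))
    ... | suc _ = []·-mono {A v} {NA w} _ (λ Av → neighbour Av (subst (0 <_) (sym eq) z<s))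

  scaled-totals : sum r ≡ sum c
  scaled-totals = *-cancelˡ-≡ (sum r) (sum c) N (begin
    N * sum r                          ≡⟨ *-distribˡ-sum N r ⟩
    sum (λ v → N * r v)                ≡⟨ sum-cong-≗ rowSum ⟨
    sum (λ v → sum (Y v))              ≡⟨ ∑-comm Y ⟩
    sum (λ w → sum (λ v → Y v w))      ≡⟨ sum-cong-≗ colSum ⟩
    sum (λ w → N * c w)                ≡⟨ *-distribˡ-sum N c ⟨
    N * sum c                          ∎)
    where open ≡-Reasoning

  scaled-transport : Transport r c
  scaled-transport = hall (sum r) ≤-refl scaled-hall-condition

-- Multiplicities and pairings

module _ {n : ℕ} where

  mult-∷ : ∀ (x : Fin n) xs v → mult (x ∷ xs) v ≡ δ x v + mult xs v
  mult-∷ x xs v with x ≟ v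
  ... | yes _ = refl
  ... | no  _ = refl

  mult-∷-self : ∀ (x : Fin n) xs → mult (x ∷ xs) x ≡ suc (mult xs x)
  mult-∷-self x xs with x ≟ x
  ... | yes _   = refl
  ... | no  x≢x = ⊥-elim (x≢x refl)

  mult≡sum : ∀ (xs : Profile n) v → mult xs v ≡ sumℕ (List.map (λ x → δ x v) xs)
  mult≡sum []       v = refl
  mult≡sum (x ∷ xs) v = trans (mult-∷ x xs v) (cong (δ x v +_) (mult≡sum xs v))

  mult-↭ : ∀ {xs ys : Profile n} → xs ↭ ys → ∀ v → mult xs v ≡ mult ys v
  mult-↭ {xs} {ys} xs↭ys v = begin
    mult xs v                          ≡⟨ mult≡sum xs v ⟩
    sumℕ (List.map (λ x → δ x v) xs)   ≡⟨ sum-↭ (map⁺ _ xs↭ys) ⟩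
    sumℕ (List.map (λ x → δ x v) ys)   ≡⟨ mult≡sum ys v ⟨
    mult ys v                          ∎
    where open ≡-Reasoning

  mult-++ : ∀ (xs ys : Profile n) v → mult (xs ++ ys) v ≡ mult xs v + mult ys v
  mult-++ xs ys v = begin
    mult (xs ++ ys) v                             ≡⟨ mult≡sum (xs ++ ys) v ⟩
    sumℕ (List.map δv (xs ++ ys))                 ≡⟨ cong sumℕ (map-++ δv xs ys) ⟩
    sumℕ (List.map δv xs ++ List.map δv ys)       ≡⟨ sum-++ (List.map δv xs) _ ⟩
    sumℕ (List.map δv xs) + sumℕ (List.map δv ys) ≡⟨ cong₂ _+_ (mult≡sum xs v) (mult≡sum ys v) ⟨
    mult xs v + mult ys v                         ∎
    where
    open ≡-Reasoning
    δv : Fin n → ℕ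
    δv x = δ x v

  mult-^ᵖ : ∀ (π : Profile n) j v → mult (π ^ᵖ j) v ≡ j * mult π v
  mult-^ᵖ π zero    v = refl
  mult-^ᵖ π (suc j) v = trans (mult-++ π (π ^ᵖ j) v) (cong (mult π v +_) (mult-^ᵖ π j v))

  mult-positive⇒∈ : ∀ (xs : Profile n) {v} → 0 < mult xs v → v ∈ xs
  mult-positive⇒∈ (x ∷ xs) {v} 0<mult with x ≟ v
  ... | yes refl = here refl
  ... | no  _    = there (mult-positive⇒∈ xs 0<mult)

  mult-≗⇒↭ : ∀ (xs ys : Profile n) → (∀ v → mult xs v ≡ mult ys v) → xs ↭ ys
  mult-≗⇒↭ [] []       _   = ↭-refl
  mult-≗⇒↭ [] (y ∷ ys) eq with () ← trans (eq y) (mult-∷-self y ys)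
  mult-≗⇒↭ (x ∷ xs) ys eq
    with ∈-∃++ (mult-positive⇒∈ ys (subst (0 <_) (trans (sym (mult-∷-self x xs)) (eq x)) z<s))
  ... | as , bs , refl = ↭-trans (prep x (mult-≗⇒↭ xs (as ++ bs) eq′)) (↭-sym (shift x as bs))
    where
    eq′ : ∀ v → mult xs v ≡ mult (as ++ bs) v
    eq′ v = +-cancelˡ-≡ (δ x v) _ _ (begin
      δ x v + mult xs v           ≡⟨ mult-∷ x xs v ⟨
      mult (x ∷ xs) v             ≡⟨ eq v ⟩
      mult (as ++ [ x ] ++ bs) v  ≡⟨ mult-↭ (shift x as bs) v ⟩
      mult (x ∷ as ++ bs) v       ≡⟨ mult-∷ x (as ++ bs) v ⟩
      δ x v + mult (as ++ bs) v   ∎)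
      where open ≡-Reasoning

module Pairs {n : ℕ} (d : Fin n → Fin n → ℕ) where
  open Dist d

  count : List (Fin n × Fin n) → Fin n → Fin n → ℕ
  count []            x y = 0
  count ((a , b) ∷ P) x y = [ does (a ≟ x) ]· δ b y + count P x y

  mult-flatten : ∀ P x → mult (flatten P) x ≡ sum (count P x) + sum (λ y → count P y x)
  mult-flatten []            x = sym (cong₂ _+_ (sum-replicate-zero n) (sum-replicate-zero n))
  mult-flatten ((a , b) ∷ P) x = begin
    mult (a ∷ b ∷ flatten P) x                                      ≡⟨ mult-∷ a _ x ⟩
    δ a x + mult (b ∷ flatten P) x                                  ≡⟨ cong (δ a x +_) (mult-∷ b _ x) ⟩
    δ a x + (δ b x + mult (flatten P) x)                            ≡⟨ cong (λ m → δ a x + (δ b x + m)) IH ⟩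
    δ a x + (δ b x + (sum (count P x) + sum (λ y → count P y x)))   ≡⟨ +-assoc (δ a x) _ _ ⟨
    δ a x + δ b x + (sum (count P x) + sum (λ y → count P y x))     ≡⟨ interchange (δ a x) (δ b x) _ _ ⟩
    (δ a x + sum (count P x)) + (δ b x + sum (λ y → count P y x))   ≡⟨ cong₂ _+_ row col ⟨
    sum (count ((a , b) ∷ P) x) + sum (λ y → count ((a , b) ∷ P) y x) ∎
    where
    open ≡-Reasoning
    IH : mult (flatten P) x ≡ sum (count P x) + sum (λ y → count P y x)
    IH = mult-flatten P x
    row : sum (count ((a , b) ∷ P) x) ≡ δ a x + sum (count P x)
    row = trans (∑-distrib-+ _ (count P x))
      (cong (_+ sum (count P x)) (trans (sum-[]· (does (a ≟ x)) (δ b)) (cong ([ does (a ≟ x) ]·_) (sum-δ-1 b))))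
    col : sum (λ y → count ((a , b) ∷ P) y x) ≡ δ b x + sum (λ y → count P y x)
    col = trans (∑-distrib-+ _ (λ y → count P y x)) (cong (_+ sum (λ y → count P y x)) (sum-δ (λ _ → δ b x) a))

  count-positive⇒∈ : ∀ P {x y} → 0 < count P x y → (x , y) ∈ P
  count-positive⇒∈ ((a , b) ∷ P) {x} {y} 0<count with a ≟ x | b ≟ y
  ... | yes refl | yes refl = here refl
  ... | yes refl | no  _    = there (count-positive⇒∈ P 0<count)
  ... | no  _    | _        = there (count-positive⇒∈ P 0<count)

  count-++ : ∀ P Q x y → count (P ++ Q) x y ≡ count P x y + count Q x y
  count-++ []            Q x y = refl
  count-++ ((a , b) ∷ P) Q x y =
    trans (cong ([ does (a ≟ x) ]· δ b y +_) (count-++ P Q x y)) (sym (+-assoc ([ does (a ≟ x) ]· δ b y) _ _))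

  count-concat-tabulate : ∀ {k} (f : Fin k → List (Fin n × Fin n)) x y →
    count (List.concat (List.tabulate f)) x y ≡ sum (λ i → count (f i) x y)
  count-concat-tabulate {zero}  f x y = refl
  count-concat-tabulate {suc k} f x y =
    trans (count-++ (f zero) _ x y) (cong (count (f zero) x y +_) (count-concat-tabulate (f ∘ suc) x y))

  count-replicate : ∀ k a b x y →
    count (List.replicate k (a , b)) x y ≡ [ does (a ≟ x) ]· [ does (b ≟ y) ]· k
  count-replicate zero    a b x y =
    sym (trans (cong ([ does (a ≟ x) ]·_) ([]·-zero (does (b ≟ y)))) ([]·-zero (does (a ≟ x))))
  count-replicate (suc k) a b x y = begin
    [ a≟x ]· δ b y + count (List.replicate k (a , b)) x y ≡⟨ cong ([ a≟x ]· δ b y +_) (count-replicate k a b x y) ⟩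
    [ a≟x ]· δ b y + [ a≟x ]· [ b≟y ]· k                  ≡⟨ []·-distrib-+ a≟x (δ b y) _ ⟨
    [ a≟x ]· (δ b y + [ b≟y ]· k)                         ≡⟨ cong ([ a≟x ]·_) ([]·-distrib-+ b≟y 1 k) ⟨
    [ a≟x ]· [ b≟y ]· suc k                               ∎
    where
    open ≡-Reasoning
    a≟x b≟y : Bool
    a≟x = does (a ≟ x)
    b≟y = does (b ≟ y)

  pairsOf : (Fin n → Fin n → ℕ) → List (Fin n × Fin n)
  pairsOf Z = List.concat (List.tabulate λ v → List.concat (List.tabulate λ w → List.replicate (Z v w) (v , w)))

  count-pairsOf : ∀ Z x y → count (pairsOf Z) x y ≡ Z x y
  count-pairsOf Z x y = begin
    count (pairsOf Z) x y
      ≡⟨ count-concat-tabulate {n} _ x y ⟩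
    sum (λ v → count (List.concat (List.tabulate λ w → List.replicate (Z v w) (v , w))) x y)
      ≡⟨ sum-cong-≗ (λ v → count-concat-tabulate (λ w → List.replicate (Z v w) (v , w)) x y) ⟩
    sum (λ v → sum (λ w → count (List.replicate (Z v w) (v , w)) x y))
      ≡⟨ sum-cong-≗ (λ v → sum-cong-≗ (λ w → count-replicate (Z v w) v w x y)) ⟩
    sum (λ v → sum (λ w → [ does (v ≟ x) ]· [ does (w ≟ y) ]· Z v w))
      ≡⟨ sum-cong-≗ (λ v → sum-[]· (does (v ≟ x)) (λ w → [ does (w ≟ y) ]· Z v w)) ⟩
    sum (λ v → [ does (v ≟ x) ]· sum (λ w → [ does (w ≟ y) ]· Z v w))
      ≡⟨ sum-cong-≗ (λ v → cong ([ does (v ≟ x) ]·_) (sum-δ′ (Z v) y)) ⟩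
    sum (λ v → [ does (v ≟ x) ]· Z v y)
      ≡⟨ sum-δ′ (λ v → Z v y) x ⟩
    Z x y
      ∎
    where open ≡-Reasoning

-- Clearing denominators

∏ : ∀ {k} → (Fin k → ℕ) → ℕ
∏ {zero}  f = 1
∏ {suc k} f = f zero * ∏ (f ∘ suc)

∣-∏ : ∀ {k} (f : Fin k → ℕ) i → f i ∣ ∏ f
∣-∏ f zero    = m∣m*n (∏ (f ∘ suc))
∣-∏ f (suc i) = ∣n⇒∣m*n (f zero) (∣-∏ (f ∘ suc) i)

∏-nonZero : ∀ {k} (f : Fin k → ℕ) → (∀ i → NonZero (f i)) → NonZero (∏ f)
∏-nonZero {zero}  f _   = _
∏-nonZero {suc k} f f≢0 = m*n≢0 (f zero) (∏ (f ∘ suc)) {{f≢0 zero}} {{∏-nonZero (f ∘ suc) (f≢0 ∘ suc)}}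

module _ where
  open import Data.Integer using (+_; -[1+_])

  ℕ→ℚᵘ : ℕ → ℚᵘ
  ℕ→ℚᵘ k = mkℚᵘ (+ k) 0

  ℕ→ℚᵘ-+ : ∀ a b → ℕ→ℚᵘ a +ᵘ ℕ→ℚᵘ b ≃ ℕ→ℚᵘ (a + b)
  ℕ→ℚᵘ-+ a b = *≡* (begin
    (+ a ℤ.* + 1 ℤ.+ + b ℤ.* + 1) ℤ.* + 1 ≡⟨ ℤ.*-identityʳ _ ⟩
    + a ℤ.* + 1 ℤ.+ + b ℤ.* + 1            ≡⟨ cong₂ ℤ._+_ (ℤ.*-identityʳ (+ a)) (ℤ.*-identityʳ (+ b)) ⟩
    + a ℤ.+ + b                            ≡⟨ ℤ.pos-+ a b ⟨
    + (a + b)                              ≡⟨ ℤ.*-identityʳ _ ⟨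
    + (a + b) ℤ.* + 1                      ∎)
    where open ≡-Reasoning

  ℕ→ℚᵘ-* : ∀ a b → ℕ→ℚᵘ a *ᵘ ℕ→ℚᵘ b ≃ ℕ→ℚᵘ (a * b)
  ℕ→ℚᵘ-* a b = *≡* (cong (ℤ._* + 1) (sym (ℤ.pos-* a b)))

  ℕ→ℚᵘ-injective : ∀ {a b} → ℕ→ℚᵘ a ≃ ℕ→ℚᵘ b → a ≡ b
  ℕ→ℚᵘ-injective {a} {b} (*≡* eq) =
    ℤ.+-injective (trans (sym (ℤ.*-identityʳ (+ a))) (trans eq (ℤ.*-identityʳ (+ b))))

  infix 4 _·_≃ℕ_

  _·_≃ℕ_ : ℚ → ℕ → ℕ → Set
  q · N ≃ℕ k = toℚᵘ q *ᵘ ℕ→ℚᵘ N ≃ ℕ→ℚᵘ k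

  ·≃ℕ-unique : ∀ q {N a b} → q · N ≃ℕ a → q · N ≃ℕ b → a ≡ b
  ·≃ℕ-unique _ qN≃a qN≃b = ℕ→ℚᵘ-injective (ℚᵘ.≃-trans (ℚᵘ.≃-sym qN≃a) qN≃b)

  clear-denominator : ∀ q {N} → 0ℚ ≤ℚ q → ↧ₙ q ∣ N → ∃ λ k → q · N ≃ℕ k
  clear-denominator (mkℚ -[1+ _ ] _ _) (*≤* ()) _
  clear-denominator (mkℚ (+ p) d-1 _) _ (divides e refl) = p * e , *≡* (begin
    (+ p ℤ.* + (e * suc d-1)) ℤ.* + 1   ≡⟨ cong (ℤ._* + 1) (ℤ.pos-* p (e * suc d-1)) ⟨
    + (p * (e * suc d-1)) ℤ.* + 1       ≡⟨ ℤ.pos-* (p * (e * suc d-1)) 1 ⟨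
    + (p * (e * suc d-1) * 1)           ≡⟨ cong +_ arithmetic ⟩
    + (p * e * suc (d-1 * 1))           ≡⟨ ℤ.pos-* (p * e) _ ⟩
    + (p * e) ℤ.* + suc (d-1 * 1)       ∎)
    where
    open ≡-Reasoning
    arithmetic : p * (e * suc d-1) * 1 ≡ p * e * suc (d-1 * 1)
    arithmetic = trans (*-identityʳ _)
      (trans (sym (*-assoc p e (suc d-1))) (cong (λ m → p * e * suc m) (sym (*-identityʳ d-1))))

  clear-denominators : ∀ {m n} (x : Fin m → Fin n → ℚ) → (∀ v w → 0ℚ ≤ℚ x v w) →
    Σ ℕ λ N → NonZero N × Σ (Fin m → Fin n → ℕ) λ X → ∀ v w → x v w · N ≃ℕ X v w
  clear-denominators x 0≤x = N , N≢0 , (λ v w → proj₁ (cleared v w)) , (λ v w → proj₂ (cleared v w))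
    where
    N : ℕ
    N = ∏ (λ v → ∏ (λ w → ↧ₙ (x v w)))
    N≢0 : NonZero N
    N≢0 = ∏-nonZero _ (λ v → ∏-nonZero (λ w → ↧ₙ (x v w)) (λ _ → _))
    cleared : ∀ v w → ∃ λ k → x v w · N ≃ℕ k
    cleared v w = clear-denominator (x v w) (0≤x v w) (∣-trans (∣-∏ _ w) (∣-∏ _ v))

  module _ {N : ℕ} where

    ·≃ℕ-+ : ∀ {p q a b} → p · N ≃ℕ a → q · N ≃ℕ b → p +ℚ q · N ≃ℕ a + b
    ·≃ℕ-+ {p} {q} {a} {b} pN≃a qN≃b = begin
      toℚᵘ (p +ℚ q) *ᵘ ℕ→ℚᵘ N               ≈⟨ ℚᵘ.*-congʳ (toℚᵘ-homo-+ p q) ⟩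
      (toℚᵘ p +ᵘ toℚᵘ q) *ᵘ ℕ→ℚᵘ N          ≈⟨ ℚᵘ.*-distribʳ-+ (ℕ→ℚᵘ N) (toℚᵘ p) (toℚᵘ q) ⟩
      toℚᵘ p *ᵘ ℕ→ℚᵘ N +ᵘ toℚᵘ q *ᵘ ℕ→ℚᵘ N  ≈⟨ ℚᵘ.+-cong pN≃a qN≃b ⟩
      ℕ→ℚᵘ a +ᵘ ℕ→ℚᵘ b                      ≈⟨ ℕ→ℚᵘ-+ a b ⟩
      ℕ→ℚᵘ (a + b)                          ∎
      where open ℚᵘ.≃-Reasoning

    ·≃ℕ-sum : ∀ {k} (f : Fin k → ℚ) (g : Fin k → ℕ) → (∀ i → f i · N ≃ℕ g i) →
      List.foldr _+ℚ_ 0ℚ (List.map f (List.allFin k)) · N ≃ℕ sum g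
    ·≃ℕ-sum f g fN≃g rewrite map-tabulate (λ i → i) f = ·≃ℕ-sum-tabulate f g fN≃g
      where
      ·≃ℕ-sum-tabulate : ∀ {k} (f : Fin k → ℚ) (g : Fin k → ℕ) → (∀ i → f i · N ≃ℕ g i) →
        List.foldr _+ℚ_ 0ℚ (List.tabulate f) · N ≃ℕ sum g
      ·≃ℕ-sum-tabulate {zero}  f g _    = *≡* refl
      ·≃ℕ-sum-tabulate {suc k} f g fN≃g =
        ·≃ℕ-+ {f zero} (fN≃g zero) (·≃ℕ-sum-tabulate (f ∘ suc) (g ∘ suc) (fN≃g ∘ suc))

-- Distances and perfect pairings

module Metric {n : ℕ} (G : SimpleGraph n) (d : Fin n → Fin n → ℕ) (isDistance : IsDistance G d) where
  open IsDistance isDistance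
  open Dist d

  private
    _++ʷ_ : ∀ {a b c k l} → Walk G a b k → Walk G b c l → Walk G a c (k + l)
    here       ++ʷ q = q
    step ab p  ++ʷ q = step ab (p ++ʷ q)

    reverseʷ : ∀ {a b k} → Walk G a b k → Walk G b a k
    reverseʷ here                 = here
    reverseʷ {k = suc k} (step ab p) =
      subst (Walk G _ _) (+-comm k 1) (reverseʷ p ++ʷ step (SimpleGraph.sym G ab) here)

  d-sym : ∀ a b → d a b ≡ d b a
  d-sym a b = ≤-antisym (minimal a b _ (reverseʷ (realised b a))) (minimal b a _ (reverseʷ (realised a b)))

  d-triangle : ∀ a b c → d a c ≤ d a b + d b c
  d-triangle a b c = minimal a c _ (realised a b ++ʷ realised b c)

  InInterval-sym : ∀ {u a b} → InInterval u a b → InInterval u b a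
  InInterval-sym {u} {a} {b} u∈Iab = begin
    d b u + d u a ≡⟨ cong₂ _+_ (d-sym b u) (d-sym u a) ⟩
    d u b + d a u ≡⟨ +-comm (d u b) (d a u) ⟩
    d a u + d u b ≡⟨ u∈Iab ⟩
    d a b         ≡⟨ d-sym a b ⟩
    d b a         ∎
    where open ≡-Reasoning

  Between : Fin n → Fin n × Fin n → Set
  Between u (a , b) = InInterval u a b

  d≤d+d : ∀ u a b → d a b ≤ d u a + d u b
  d≤d+d u a b = subst (λ x → d a b ≤ x + d u b) (d-sym a u) (d-triangle a u b)

  F-↭ : ∀ {xs ys} → xs ↭ ys → ∀ u → F xs u ≡ F ys u
  F-↭ xs↭ys u = sum-↭ (map⁺ (d u) xs↭ys)

  F-flatten-∷ : ∀ u a b P → F (flatten ((a , b) ∷ P)) u ≡ (d u a + d u b) + F (flatten P) u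
  F-flatten-∷ u a b P = sym (+-assoc (d u a) (d u b) _)

  D≤F : ∀ u P → D P ≤ F (flatten P) u
  D≤F u []            = z≤n
  D≤F u ((a , b) ∷ P) = ≤-trans (+-mono-≤ (d≤d+d u a b) (D≤F u P)) (≤-reflexive (sym (F-flatten-∷ u a b P)))

  D≡F⇒Between : ∀ u P → D P ≡ F (flatten P) u → All (Between u) P
  D≡F⇒Between u []            _   = []
  D≡F⇒Between u ((a , b) ∷ P) D≡F with +-≤-≡⇒≡ (d≤d+d u a b) (D≤F u P) (trans D≡F (F-flatten-∷ u a b P))
  ... | dab≡ , DP≡ = trans (cong (_+ d u b) (d-sym a u)) (sym dab≡) ∷ D≡F⇒Between u P DP≡

  Between⇒D≡F : ∀ u P → All (Between u) P → D P ≡ F (flatten P) u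
  Between⇒D≡F u []            []               = refl
  Between⇒D≡F u ((a , b) ∷ P) (u∈Iab ∷ between) = trans
    (cong₂ _+_ (trans (sym u∈Iab) (cong (_+ d u b) (d-sym a u))) (Between⇒D≡F u P between))
    (sym (F-flatten-∷ u a b P))

  -- scale · x for some x ∈ dM(π,u), as a symmetric ℕ-matrix whose diagonal entries are doubled
  -- (a loop counts twice in the degree condition of dM).
  record ScaledMatching (u : Fin n) (π : Profile n) : Set where
    field
      scale        : ℕ
      .{{scale≢0}} : NonZero scale
      weights      : Fin n → Fin n → ℕ
      symmetric    : ∀ v w → weights v w ≡ weights w v
      rowSum       : ∀ v → sum (weights v) ≡ scale * mult π v
      between      : ∀ v w → 0 < weights v w → InInterval u v w

    colSum : ∀ w → sum (λ v → weights v w) ≡ scale * mult π w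
    colSum w = trans (sum-cong-≗ (λ v → symmetric v w)) (rowSum w)

  open Pairs d

  perfect-pairing-of-square : ∀ {u π} → ScaledMatching u π → AdmitsPerfectPairing (π ^ᵖ 2)
  perfect-pairing-of-square {u} {π} M =
    pairsOf Z , isPairing , u , trans (Between⇒D≡F u (pairsOf Z) all-between) (F-↭ isPairing u)
    where
    open ScaledMatching M
    open Hall (λ v w → 0 <? weights v w) using (Transport; module Transport)
    transport : Transport (mult π) (mult π)
    transport = scaled-transport weights scale rowSum colSum
    open Transport transport using (support) renaming (plan to Z)
    Zcol : ∀ y → sum (λ x → Z x y) ≡ mult π y
    Zcol = Transport.colSum transport (scaled-totals weights scale rowSum colSum)
    isPairing : flatten (pairsOf Z) ↭ π ^ᵖ 2
    isPairing = mult-≗⇒↭ _ _ λ x → begin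
      mult (flatten (pairsOf Z)) x
        ≡⟨ mult-flatten (pairsOf Z) x ⟩
      sum (count (pairsOf Z) x) + sum (λ y → count (pairsOf Z) y x)
        ≡⟨ cong₂ _+_ (sum-cong-≗ (count-pairsOf Z x)) (sum-cong-≗ (λ y → count-pairsOf Z y x)) ⟩
      sum (Z x) + sum (λ y → Z y x)  ≡⟨ cong₂ _+_ (Transport.rowSum transport x) (Zcol x) ⟩
      mult π x + mult π x            ≡⟨ cong (mult π x +_) (+-identityʳ (mult π x)) ⟨
      2 * mult π x                   ≡⟨ mult-^ᵖ π 2 x ⟨
      mult (π ^ᵖ 2) x                ∎
      where open ≡-Reasoning
    replicate-between : ∀ v w → All (Between u) (List.replicate (Z v w) (v , w))
    replicate-between v w with Z v w in eq
    ... | zero  = []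
    ... | suc k = replicate⁺ (suc k) (between v w (support v w (subst (0 <_) (sym eq) z<s)))
    all-between : All (Between u) (pairsOf Z)
    all-between = concat⁺ (tabulate⁺ λ v → concat⁺ (tabulate⁺ λ w → replicate-between v w))

  scaled-matching-of-perfect-pairing : ∀ {π} j .{{_ : NonZero j}} → AdmitsPerfectPairing (π ^ᵖ j) →
    ∃ λ u → ScaledMatching u π
  scaled-matching-of-perfect-pairing {π} j (P , P↭πʲ , u , D≡F) = u , record
    { scale     = j
    ; weights   = Y
    ; symmetric = λ x y → +-comm (count P x y) (count P y x)
    ; rowSum    = rowSum
    ; between   = between
    }
    where
    Y : Fin n → Fin n → ℕ
    Y x y = count P x y + count P y x
    rowSum : ∀ x → sum (Y x) ≡ j * mult π x
    rowSum x = begin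
      sum (Y x)                                   ≡⟨ ∑-distrib-+ (count P x) (λ y → count P y x) ⟩
      sum (count P x) + sum (λ y → count P y x)   ≡⟨ mult-flatten P x ⟨
      mult (flatten P) x                          ≡⟨ mult-↭ P↭πʲ x ⟩
      mult (π ^ᵖ j) x                             ≡⟨ mult-^ᵖ π j x ⟩
      j * mult π x                                ∎
      where open ≡-Reasoning
    all-between : All (Between u) P
    all-between = D≡F⇒Between u P (trans D≡F (sym (F-↭ P↭πʲ u)))
    between : ∀ x y → 0 < Y x y → InInterval u x y
    between x y 0<Y with +-positive (count P x y) 0<Y
    ... | inj₁ 0<Pxy = All.lookup all-between (count-positive⇒∈ P 0<Pxy)
    ... | inj₂ 0<Pyx = InInterval-sym (All.lookup all-between (count-positive⇒∈ P 0<Pyx))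

  scaled-matching-of-dM : ∀ {π u x} → InDM π u x → ScaledMatching u π
  scaled-matching-of-dM {π} {u} {x} x∈dM with clear-denominators x (InDM.nonneg x∈dM)
  ... | N , N≢0 , X , clears = record
    { scale     = N
    ; scale≢0   = N≢0
    ; weights   = Y
    ; symmetric = λ v w → cong₂ _+_ (X-sym v w) (cong₂ [_]·_ (≟-sym v w) (X-sym v w))
    ; rowSum    = rowSum
    ; between   = between
    }
    where
    open InDM x∈dM
    X-sym : ∀ v w → X v w ≡ X w v
    X-sym v w = ·≃ℕ-unique (x v w) (clears v w) (subst (λ q → q · N ≃ℕ X w v) (symmetric w v) (clears w v))
    X-row : ∀ v → sum (X v) + X v v ≡ N * mult π v
    X-row v = ·≃ℕ-unique (row +ℚ x v v) (·≃ℕ-+ {N} {row} (·≃ℕ-sum (x v) (X v) (clears v)) (clears v v)) (begin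
      toℚᵘ (row +ℚ x v v) *ᵘ ℕ→ℚᵘ N      ≈⟨ ℚᵘ.*-congʳ (toℚᵘ-cong (degree v)) ⟩
      toℚᵘ (ℕ→ℚ (mult π v)) *ᵘ ℕ→ℚᵘ N    ≈⟨ ℚᵘ.*-congʳ (toℚᵘ-fromℚᵘ (ℕ→ℚᵘ (mult π v))) ⟩
      ℕ→ℚᵘ (mult π v) *ᵘ ℕ→ℚᵘ N          ≈⟨ ℕ→ℚᵘ-* (mult π v) N ⟩
      ℕ→ℚᵘ (mult π v * N)                ≡⟨ cong ℕ→ℚᵘ (*-comm (mult π v) N) ⟩
      ℕ→ℚᵘ (N * mult π v)                ∎)
      where
      open ℚᵘ.≃-Reasoning
      row : ℚ
      row = sumℚ (List.map (x v) (List.allFin n))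
    X-support : ∀ v w → ¬ InInterval u v w → X v w ≡ 0
    X-support v w u∉Ivw =
      ·≃ℕ-unique (x v w) (clears v w) (subst (λ q → q · N ≃ℕ 0) (sym (support v w u∉Ivw)) (ℚᵘ.*-zeroˡ (ℕ→ℚᵘ N)))
    Y : Fin n → Fin n → ℕ
    Y v w = X v w + [ does (v ≟ w) ]· X v w
    rowSum : ∀ v → sum (Y v) ≡ N * mult π v
    rowSum v = trans (∑-distrib-+ (X v) _) (trans (cong (sum (X v) +_) (sum-δ (X v) v)) (X-row v))
    between : ∀ v w → 0 < Y v w → InInterval u v w
    between v w 0<Y with d v u + d u w ≟ℕ d v w
    ... | yes u∈Ivw = u∈Ivw
    ... | no  u∉Ivw = ⊥-elim (<-irrefl refl (subst (0 <_) Y≡0 0<Y))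
      where
      Y≡0 : Y v w ≡ 0
      Y≡0 = trans (cong (λ k → k + [ does (v ≟ w) ]· k) (X-support v w u∉Ivw)) ([]·-zero (does (v ≟ w)))

lemma25 : (n : ℕ) (G : SimpleGraph n) (d : Fin n → Fin n → ℕ) → IsDistance G d →
    (u : Fin n) (π : Profile n) →
    (Dist.DMNonEmpty d π u → Dist.AdmitsPerfectPairing d (π ^ᵖ 2))
    × ((k : ℕ) → 1 ≤ k → Dist.AdmitsPerfectPairing d (π ^ᵖ (2 * k)) → Dist.AdmitsPerfectPairing d (π ^ᵖ 2))
lemma25 n G d isDistance u π = from-dM , from-power
  where
  open Metric G d isDistance
  from-dM : Dist.DMNonEmpty d π u → Dist.AdmitsPerfectPairing d (π ^ᵖ 2)
  from-dM (x , x∈dM) = perfect-pairing-of-square (scaled-matching-of-dM x∈dM)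
  from-power : ∀ k → 1 ≤ k → Dist.AdmitsPerfectPairing d (π ^ᵖ (2 * k)) → Dist.AdmitsPerfectPairing d (π ^ᵖ 2)
  from-power zero    () _
  from-power (suc k) _  P = perfect-pairing-of-square (proj₂ (scaled-matching-of-perfect-pairing (2 * suc k) P))
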